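{- Let $\theta$ be a standardized holey $\{\exists,\wedge\}$-formula of the form $\phi\wedge\phi'$, and let $a$ be an association for $\theta$. Then $\mathsf{width}([\phi\wedge\phi']_{\mathcal{T}\setminus\{N\}})=\max\big(\mathsf{width}([\phi]_{\mathcal{T}\setminus\{N\}}),\ \mathsf{width}([\phi']_{\mathcal{T}\setminus\{N\}}),\ |\mathrm{free}(\phi)\cup\mathrm{free}(\phi')|\big).$
   Context: A holey pfo-formula is built as follows: each natural number $i\ge1$ is a holey formula (a hole); if $\phi,\phi'$ are holey formulas, so are $\phi\wedge\phi'$, $\phi\vee\phi'$, $\exists x\phi$, $\forall x\phi$; no natural number may occur more than once. A holey $\{\exists,\wedge\}$-formula uses only holes, $\wedge$ and $\exists$. An association for a holey formula is a partial map $a$ defined on all its holes, with $a(i)$ a set of variables; it determines $\mathrm{free}(\cdot)$ on all subformulas via $\mathrm{free}(i)=a(i)$ and the usual inductive rules. The width of a (holey) formula is the maximum of $|\mathrm{free}(\psi)|$ over its subformulas $\psi$; for a set $S$ of formulas, $\mathsf{width}(S)=\inf\{\mathsf{width}(\psi):\psi\in S\}$. A formula is standardized if for each occurrence of a quantification $Qx$, $x$ is quantified at no other occurrence and $x$ is not free in the whole formula. Rewriting rules (applicable to any subformula occurrence, free variables computed via the association; $\oplus\in\{\wedge,\vee\}$, $Q\in\{\exists,\forall\}$): $A$: $F_1\oplus(F_2\oplus F_3)\to(F_1\oplus F_2)\oplus F_3$ and its converse; $C$: $F_1\oplus F_2\to F_2\oplus F_1$; $O$: $QxQyF\to QyQxF$;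 $P\!\downarrow$: $\exists x(F_1\wedge F_2)\to(\exists xF_1)\wedge F_2$ and $\forall x(F_1\vee F_2)\to(\forall xF_1)\vee F_2$ whenever $x\notin\mathrm{free}(F_2)$; $P\!\uparrow$: inverse of $P\!\downarrow$. $[\psi]_{\mathcal{T}\setminus\{N\}}$ is the equivalence class of $\psi$ under the reflexive-transitive closure of the union of the rules $A,C,O,P\!\downarrow,P\!\uparrow$ and their inverses (for $\phi,\phi'$ the association is the restriction of $a$). -}

module Defs where

open import Data.Nat using (ℕ; _≤_; _⊔_; _≟_)
open import Data.List using (List; []; _∷_; _++_; filter; deduplicate; length)
open import Data.List.Membership.Propositional using (_∈_; _∉_)
open import Data.List.Relation.Unary.Unique.Propositional using (Unique)
open import Data.List.Relation.Unary.All using (All)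
open import Data.Product using (Σ; _×_)
open import Data.Sum using (_⊎_)
open import Relation.Nullary using (¬?)
open import Relation.Binary.PropositionalEquality using (_≡_)
open import Relation.Binary.Construct.Closure.ReflexiveTransitive using (Star)

Var : Set
Var = ℕ

data Op : Set where
  and or : Op

data Qu : Set where
  ex all : Qu

-- Holey pfo-formulas (uniqueness of hole labels is a separate predicate).
data HF : Set where
  hole : ℕ → HF
  bin  : Op → HF → HF → HF
  qu   : Qu → Var → HF → HF

holes : HF → List ℕ
holes (hole i) = i ∷ []
holes (bin _ φ ψ) = holes φ ++ holes ψ
holes (qu _ _ φ) = holes φ

IsHoley : HF → Set
IsHoley φ = Unique (holes φ)

data IsExAnd : HF → Set where
  h  : ∀ i → IsExAnd (hole i)
  c  : ∀ {φ ψ} → IsExAnd φ → IsExAnd ψ → IsExAnd (bin and φ ψ)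
  e  : ∀ {x φ} → IsExAnd φ → IsExAnd (qu ex x φ)

-- An association: sets of variables (as lists) attached to hole labels.
-- Only its values on the holes of the formula matter.
Assoc : Set
Assoc = ℕ → List Var

remove : Var → List Var → List Var
remove x = filter (λ y → ¬? (x ≟ y))

free : Assoc → HF → List Var
free a (hole i) = a i
free a (bin _ φ ψ) = free a φ ++ free a ψ
free a (qu _ x φ) = remove x (free a φ)

card : List Var → ℕ
card xs = length (deduplicate _≟_ xs)

width : Assoc → HF → ℕ
width a (hole i) = card (a i)
width a (bin o φ ψ) = card (free a (bin o φ ψ)) ⊔ (width a φ ⊔ width a ψ)
width a (qu q x φ) = card (free a (qu q x φ)) ⊔ width a φ

bound : HF → List Var
bound (hole i) = []
bound (bin _ φ ψ) = bound φ ++ bound ψ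
bound (qu _ x φ) = x ∷ bound φ

Standardized : Assoc → HF → Set
Standardized a φ = Unique (bound φ) × All (λ x → x ∉ free a φ) (bound φ)

data Step (a : Assoc) : HF → HF → Set where
  A→   : ∀ o F₁ F₂ F₃ → Step a (bin o F₁ (bin o F₂ F₃)) (bin o (bin o F₁ F₂) F₃)
  A←   : ∀ o F₁ F₂ F₃ → Step a (bin o (bin o F₁ F₂) F₃) (bin o F₁ (bin o F₂ F₃))
  C    : ∀ o F₁ F₂ → Step a (bin o F₁ F₂) (bin o F₂ F₁)
  O    : ∀ q x y F → Step a (qu q x (qu q y F)) (qu q y (qu q x F))
  P↓∃  : ∀ x F₁ F₂ → x ∉ free a F₂ →
         Step a (qu ex x (bin and F₁ F₂)) (bin and (qu ex x F₁) F₂)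
  P↓∀  : ∀ x F₁ F₂ → x ∉ free a F₂ →
         Step a (qu all x (bin or F₁ F₂)) (bin or (qu all x F₁) F₂)
  P↑∃  : ∀ x F₁ F₂ → x ∉ free a F₂ →
         Step a (bin and (qu ex x F₁) F₂) (qu ex x (bin and F₁ F₂))
  P↑∀  : ∀ x F₁ F₂ → x ∉ free a F₂ →
         Step a (bin or (qu all x F₁) F₂) (qu all x (bin or F₁ F₂))
  congL : ∀ {F F'} o G → Step a F F' → Step a (bin o F G) (bin o F' G)
  congR : ∀ {G G'} o F → Step a G G' → Step a (bin o F G) (bin o F G')
  congQ : ∀ {F F'} q x → Step a F F' → Step a (qu q x F) (qu q x F')

Step± : Assoc → HF → HF → Set
Step± a φ ψ = Step a φ ψ ⊎ Step a ψ φ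

-- membership in the class [φ]_{T∖{N}}: reflexive–transitive closure
Equiv : Assoc → HF → HF → Set
Equiv a φ ψ = Star (Step± a) φ ψ

-- w = width([φ]) = inf { width ψ : ψ ∈ [φ] }  (attained, since ℕ is well-ordered)
IsClassWidth : Assoc → HF → ℕ → Set
IsClassWidth a φ w =
  Σ HF (λ ψ → Equiv a φ ψ × width a ψ ≡ w) × (∀ ψ → Equiv a φ ψ → w ≤ width a ψ)

-- The upper bound is witnessed by the conjunction of optimal representatives of [φ] and [φ'].
-- For the lower bound, restrict any ψ ∈ [φ ∧ φ'] to the holes of φ: delete the holes of φ'
-- and the quantifiers over variables bound in φ'.  Every rewriting step of ψ induces zero or
-- more rewriting steps on the restriction (standardization supplies the side conditions of P↓),
-- so the restriction stays in [φ], and deleting parts of a formula does not increase its width.  The same for φ', together with the invariance of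
-- the free variables, gives the three lower bounds.
module Submission where

open import Defs
open import Function using (id; _∘_)
open import Relation.Binary.PropositionalEquality as ≡ using (_≡_; _≢_; refl; sym; cong; subst; setoid)
open import Data.Bool using (true; false)
open import Data.Nat using (ℕ; _⊔_; _≤_; _≟_; z≤n; s≤s)
open import Data.Nat.Properties
  using (≤-refl; ≤-reflexive; ≤-trans; ≤-antisym; ⊔-lub; ⊔-comm; ⊔-mono-≤; m≤m⊔n; m≤n⊔m)
open import Data.List using (List; []; _∷_; _++_; foldr; length)
open import Data.List.Properties using (foldr-++; filter-++; filter-all; length-removeAt′)
open import Data.List.Membership.Propositional using (_∈_; _∉_)
open import Data.List.Membership.Propositional.Properties
  using (∈-++⁻; ∈-++⁺ˡ; ∈-++⁺ʳ; ∈-filter⁺; ∈-deduplicate⁺; ∈-deduplicate⁻)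
open import Data.List.Membership.DecPropositional _≟_ using (_∈?_)
open import Data.List.Relation.Unary.Any using (here; there; _─_)
open import Data.List.Relation.Unary.All as All using (All; []; _∷_)
import Data.List.Relation.Unary.All.Properties as All
open import Data.List.Relation.Unary.Unique.Propositional using (Unique; []; _∷_)
open import Data.List.Relation.Unary.Unique.DecPropositional.Properties _≟_ using (deduplicate-!)
open import Data.List.Relation.Binary.Disjoint.Propositional using (Disjoint)
open import Data.List.Relation.Binary.Subset.Propositional using (_⊆_)
open import Data.List.Relation.Binary.Subset.Propositional.Properties
  using (⊆-reflexive-↭; All-resp-⊇; xs⊆xs++ys; xs⊆ys++xs; ++⁺; filter-⊆; filter⁺′)
import Data.List.Relation.Binary.Permutation.Propositional as ↭
open ↭
  using (_↭_; prep; swap; ↭-refl; ↭-sym; ↭-trans; ↭-reflexive; ↭⇒↭ₛ)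
open import Data.List.Relation.Binary.Permutation.Propositional.Properties
  using (All-resp-↭; ∈-resp-↭; ++⁺ˡ; ++⁺ʳ; ++-comm; ++-assoc; filter-↭; ∷↭∷ʳ)
open import Data.List.Relation.Binary.Permutation.Setoid.Properties (setoid ℕ) using (Unique-resp-↭)
open import Data.Maybe using (Maybe; just; nothing)
open import Data.Maybe.Relation.Unary.All as Maybe using (just; nothing)
open import Data.Product using (_×_; _,_; proj₁; proj₂; ∃-syntax)
open import Data.Sum as Sum using (_⊎_; inj₁; inj₂; [_,_]′)
open import Relation.Nullary using (Dec; yes; no; ¬?; does; contradiction)
open import Relation.Binary.Construct.Closure.ReflexiveTransitive using (ε; _◅_; _◅◅_; gmap; reverse)

private
  variable
    a : Assoc
    o : Op
    q : Qu
    x : Var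
    xs ys : List Var
    B B' F F' G G' ψ ψ' χ φ φ' : HF
    A : Set

-- Lists as finite sets

∈-─⁺ : ∀ {u z} {zs : List A} (u∈zs : u ∈ zs) → z ∈ zs → u ≢ z → z ∈ (zs ─ u∈zs)
∈-─⁺ (here refl) (here refl) u≢z = contradiction refl u≢z
∈-─⁺ (here _) (there z∈zs) _ = z∈zs
∈-─⁺ (there _) (here refl) _ = here refl
∈-─⁺ (there u∈zs) (there z∈zs) u≢z = there (∈-─⁺ u∈zs z∈zs u≢z)

Unique-length-mono : ∀ {xs ys : List A} → Unique xs → xs ⊆ ys → length xs ≤ length ys
Unique-length-mono [] _ = z≤n
Unique-length-mono {xs = x ∷ xs} {ys} (x≢xs ∷ uniq) x∷xs⊆ys =
  ≤-trans (s≤s (Unique-length-mono uniq xs⊆ys─x)) (≤-reflexive (sym (length-removeAt′ ys _)))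
  where
  x∈ys = x∷xs⊆ys (here refl)
  xs⊆ys─x : xs ⊆ (ys ─ x∈ys)
  xs⊆ys─x z∈xs = ∈-─⁺ x∈ys (x∷xs⊆ys (there z∈xs)) (All.lookup x≢xs z∈xs)

card-mono : ∀ {xs ys} → xs ⊆ ys → card xs ≤ card ys
card-mono {xs} xs⊆ys =
  Unique-length-mono (deduplicate-! xs) (∈-deduplicate⁺ _≟_ ∘ xs⊆ys ∘ ∈-deduplicate⁻ _≟_ xs)

card-↭ : ∀ {xs ys} → xs ↭ ys → card xs ≡ card ys
card-↭ p = ≤-antisym (card-mono (⊆-reflexive-↭ p)) (card-mono (⊆-reflexive-↭ (↭-sym p)))

Unique-++⁻ : ∀ (xs : List A) {ys} → Unique (xs ++ ys) → Unique xs × Unique ys × Disjoint xs ys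
Unique-++⁻ [] uniq = [] , uniq , λ ()
Unique-++⁻ (x ∷ xs) (x≢ ∷ uniq) with Unique-++⁻ xs uniq | All.++⁻ xs x≢
... | uxs , uys , disj | x≢xs , x≢ys = x≢xs ∷ uxs , uys , λ where
  (here refl , x∈ys) → All.lookup x≢ys x∈ys refl
  (there v∈xs , v∈ys) → disj (v∈xs , v∈ys)

remove-⊆ : ∀ x xs → remove x xs ⊆ xs
remove-⊆ x = filter-⊆ (λ y → ¬? (x ≟ y))

remove⁺ : ∀ x → xs ⊆ ys → remove x xs ⊆ remove x ys
remove⁺ x = filter⁺′ (λ y → ¬? (x ≟ y)) (λ y → ¬? (x ≟ y)) id

∈-remove⁺ : ∀ {y} → y ∈ xs → x ≢ y → y ∈ remove x xs
∈-remove⁺ {x = x} = ∈-filter⁺ (λ y → ¬? (x ≟ y))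

remove-comm : ∀ x y zs → remove x (remove y zs) ≡ remove y (remove x zs)
remove-comm x y [] = refl
remove-comm x y (z ∷ zs) with does (¬? (y ≟ z)) in y≢z | does (¬? (x ≟ z)) in x≢z
... | false | false = remove-comm x y zs
... | false | true rewrite y≢z = remove-comm x y zs
... | true | false rewrite x≢z = remove-comm x y zs
... | true | true rewrite x≢z | y≢z = cong (z ∷_) (remove-comm x y zs)

remove-++-∉ : ∀ xs → x ∉ ys → remove x (xs ++ ys) ≡ remove x xs ++ ys
remove-++-∉ {x} xs x∉ys = ≡.trans (filter-++ (λ y → ¬? (x ≟ y)) xs _)
  (cong (remove x xs ++_) (filter-all (λ y → ¬? (x ≟ y)) (All.tabulate x≢ys)))
  where
  x≢ys : ∀ {y} → y ∈ _ → x ≢ y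
  x≢ys y∈ys refl = x∉ys y∈ys

-- Rewriting steps and their invariants

Step-sym : Step a ψ ψ' → Step a ψ' ψ
Step-sym (A→ o F₁ F₂ F₃) = A← o F₁ F₂ F₃
Step-sym (A← o F₁ F₂ F₃) = A→ o F₁ F₂ F₃
Step-sym (C o F₁ F₂) = C o F₂ F₁
Step-sym (O q x y F) = O q y x F
Step-sym (P↓∃ x F₁ F₂ x∉F₂) = P↑∃ x F₁ F₂ x∉F₂
Step-sym (P↓∀ x F₁ F₂ x∉F₂) = P↑∀ x F₁ F₂ x∉F₂
Step-sym (P↑∃ x F₁ F₂ x∉F₂) = P↓∃ x F₁ F₂ x∉F₂
Step-sym (P↑∀ x F₁ F₂ x∉F₂) = P↓∀ x F₁ F₂ x∉F₂
Step-sym (congL o G s) = congL o G (Step-sym s)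
Step-sym (congR o F s) = congR o F (Step-sym s)
Step-sym (congQ q x s) = congQ q x (Step-sym s)

Step±⇒Step : Step± a ψ ψ' → Step a ψ ψ'
Step±⇒Step = [ id , Step-sym ]′

free-Step : Step a ψ ψ' → free a ψ ↭ free a ψ'
free-Step {a} (A→ o F₁ F₂ F₃) = ↭-sym (++-assoc (free a F₁) (free a F₂) (free a F₃))
free-Step {a} (A← o F₁ F₂ F₃) = ++-assoc (free a F₁) (free a F₂) (free a F₃)
free-Step {a} (C o F₁ F₂) = ++-comm (free a F₁) (free a F₂)
free-Step {a} (O q x y F) = ↭-reflexive (remove-comm x y (free a F))
free-Step {a} (P↓∃ x F₁ F₂ x∉F₂) = ↭-reflexive (remove-++-∉ (free a F₁) x∉F₂)
free-Step {a} (P↓∀ x F₁ F₂ x∉F₂) = ↭-reflexive (remove-++-∉ (free a F₁) x∉F₂)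
free-Step {a} (P↑∃ x F₁ F₂ x∉F₂) = ↭-reflexive (sym (remove-++-∉ (free a F₁) x∉F₂))
free-Step {a} (P↑∀ x F₁ F₂ x∉F₂) = ↭-reflexive (sym (remove-++-∉ (free a F₁) x∉F₂))
free-Step {a} (congL o G s) = ++⁺ʳ (free a G) (free-Step s)
free-Step {a} (congR o F s) = ++⁺ˡ (free a F) (free-Step s)
free-Step (congQ q x s) = filter-↭ (λ y → ¬? (x ≟ y)) (free-Step s)

free-Equiv : Equiv a ψ ψ' → free a ψ ↭ free a ψ'
free-Equiv ε = ↭-refl
free-Equiv (s ◅ ss) = ↭-trans (free-Step (Step±⇒Step s)) (free-Equiv ss)

bound-Step : Step a ψ ψ' → bound ψ ↭ bound ψ'
bound-Step (A→ o F₁ F₂ F₃) = ↭-sym (++-assoc (bound F₁) (bound F₂) (bound F₃))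
bound-Step (A← o F₁ F₂ F₃) = ++-assoc (bound F₁) (bound F₂) (bound F₃)
bound-Step (C o F₁ F₂) = ++-comm (bound F₁) (bound F₂)
bound-Step (O q x y F) = swap x y ↭-refl
bound-Step (P↓∃ x F₁ F₂ _) = ↭-refl
bound-Step (P↓∀ x F₁ F₂ _) = ↭-refl
bound-Step (P↑∃ x F₁ F₂ _) = ↭-refl
bound-Step (P↑∀ x F₁ F₂ _) = ↭-refl
bound-Step (congL o G s) = ++⁺ʳ (bound G) (bound-Step s)
bound-Step (congR o F s) = ++⁺ˡ (bound F) (bound-Step s)
bound-Step (congQ q x s) = prep x (bound-Step s)

Standardized-Step : Step a ψ ψ' → Standardized a ψ → Standardized a ψ'
Standardized-Step s (uniq , bound∉free) =
  Unique-resp-↭ (↭⇒↭ₛ (bound-Step s)) uniq ,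
  All-resp-↭ (bound-Step s) (All.map (λ x∉ψ → x∉ψ ∘ ∈-resp-↭ (↭-sym (free-Step s))) bound∉free)

IsExAnd-Step : Step a ψ ψ' → IsExAnd ψ → IsExAnd ψ'
IsExAnd-Step (A→ o F₁ F₂ F₃) (c e₁ (c e₂ e₃)) = c (c e₁ e₂) e₃
IsExAnd-Step (A← o F₁ F₂ F₃) (c (c e₁ e₂) e₃) = c e₁ (c e₂ e₃)
IsExAnd-Step (C o F₁ F₂) (c e₁ e₂) = c e₂ e₁
IsExAnd-Step (O q x y F) (e (e e₁)) = e (e e₁)
IsExAnd-Step (P↓∃ x F₁ F₂ _) (e (c e₁ e₂)) = c (e e₁) e₂
IsExAnd-Step (P↑∃ x F₁ F₂ _) (c (e e₁) e₂) = e (c e₁ e₂)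
IsExAnd-Step (congL o G s) (c e₁ e₂) = c (IsExAnd-Step s e₁) e₂
IsExAnd-Step (congR o F s) (c e₁ e₂) = c e₁ (IsExAnd-Step s e₂)
IsExAnd-Step (congQ q x s) (e e₁) = e (IsExAnd-Step s e₁)

Standardized-binˡ : ∀ o F G → Standardized a (bin o F G) → Standardized a F
Standardized-binˡ o F G (uniq , bound∉free) =
  proj₁ (Unique-++⁻ (bound F) uniq) ,
  All.map (λ x∉ → x∉ ∘ ∈-++⁺ˡ) (All.++⁻ˡ (bound F) bound∉free)

Standardized-binʳ : ∀ o F G → Standardized a (bin o F G) → Standardized a G
Standardized-binʳ o F G = Standardized-binˡ o G F ∘ Standardized-Step (C o F G)

Standardized-qu : ∀ q x F → Standardized a (qu q x F) → Standardized a F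
Standardized-qu q x F ((x≢bound ∷ uniq) , (_ ∷ bound∉free)) =
  uniq , All.zipWith (λ (y∉ , x≢y) y∈F → y∉ (∈-remove⁺ y∈F x≢y)) (bound∉free , x≢bound)

bound-free-disjointˡ : ∀ o F G → Standardized a (bin o F G) → All (_∉ free a G) (bound F)
bound-free-disjointˡ {a} o F G (_ , bound∉free) =
  All.map (λ x∉ → x∉ ∘ ∈-++⁺ʳ (free a F)) (All.++⁻ˡ (bound F) bound∉free)

bound-free-disjointʳ : ∀ o F G → Standardized a (bin o F G) → All (_∉ free a F) (bound G)
bound-free-disjointʳ o F G = bound-free-disjointˡ o G F ∘ Standardized-Step (C o F G)

hole-var-free⊎bound : ∀ F {i y} → i ∈ holes F → y ∈ a i → y ∈ free a F ⊎ y ∈ bound F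
hole-var-free⊎bound (hole j) (here refl) y∈ai = inj₁ y∈ai
hole-var-free⊎bound {a} (bin o F G) i∈FG y∈ai with ∈-++⁻ (holes F) i∈FG
... | inj₁ i∈F = Sum.map ∈-++⁺ˡ ∈-++⁺ˡ (hole-var-free⊎bound F i∈F y∈ai)
... | inj₂ i∈G =
  Sum.map (∈-++⁺ʳ (free a F)) (∈-++⁺ʳ (bound F)) (hole-var-free⊎bound G i∈G y∈ai)
hole-var-free⊎bound (qu q x F) {y = y} i∈F y∈ai with hole-var-free⊎bound F i∈F y∈ai | x ≟ y
... | inj₂ y∈bound | _ = inj₂ (there y∈bound)
... | inj₁ _ | yes refl = inj₂ (here refl)
... | inj₁ y∈F | no x≢y = inj₁ (∈-remove⁺ y∈F x≢y)

-- The equivalence [·] and existential prefixes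

step : Step a ψ ψ' → Equiv a ψ ψ'
step s = inj₁ s ◅ ε

Equiv-sym : Equiv a ψ ψ' → Equiv a ψ' ψ
Equiv-sym = reverse Sum.swap

Equiv-binˡ : ∀ o G → Equiv a F F' → Equiv a (bin o F G) (bin o F' G)
Equiv-binˡ o G = gmap (λ F → bin o F G) (Sum.map (congL o G) (congL o G))

Equiv-binʳ : ∀ o F → Equiv a G G' → Equiv a (bin o F G) (bin o F G')
Equiv-binʳ o F = gmap (bin o F) (Sum.map (congR o F) (congR o F))

Equiv-bin : ∀ o → Equiv a F F' → Equiv a G G' → Equiv a (bin o F G) (bin o F' G')
Equiv-bin {F' = F'} {G = G} o F~F' G~G' = Equiv-binˡ o G F~F' ◅◅ Equiv-binʳ o F' G~G'

Equiv-qu : ∀ q x → Equiv a F F' → Equiv a (qu q x F) (qu q x F')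
Equiv-qu q x = gmap (qu q x) (Sum.map (congQ q x) (congQ q x))

∃* : List Var → HF → HF
∃* xs B = foldr (qu ex) B xs

∃*-++ : ∀ xs ys B → ∃* (xs ++ ys) B ≡ ∃* xs (∃* ys B)
∃*-++ xs ys B = foldr-++ (qu ex) B xs ys

∃*-cong : ∀ xs → Equiv a B B' → Equiv a (∃* xs B) (∃* xs B')
∃*-cong [] = id
∃*-cong (x ∷ xs) = Equiv-qu ex x ∘ ∃*-cong xs

∃*-↭ : xs ↭ ys → Equiv a (∃* xs B) (∃* ys B)
∃*-↭ ↭.refl = ε
∃*-↭ (prep x p) = Equiv-qu ex x (∃*-↭ p)
∃*-↭ {B = B} (swap {xs = xs} x y p) =
  step (O ex x y (∃* xs B)) ◅◅ Equiv-qu ex y (Equiv-qu ex x (∃*-↭ p))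
∃*-↭ (↭.trans p p') = ∃*-↭ p ◅◅ ∃*-↭ p'

∃*-∃ : ∀ xs → Equiv a (∃* xs (qu ex x B)) (qu ex x (∃* xs B))
∃*-∃ {x = x} {B = B} xs =
  subst (λ χ → Equiv _ χ (∃* (x ∷ xs) B)) (∃*-++ xs (x ∷ []) B) (∃*-↭ (↭-sym (∷↭∷ʳ x xs)))

∃*-++-swap : ∀ xs ys → Equiv a (∃* (xs ++ ys) B) (∃* ys (∃* xs B))
∃*-++-swap {B = B} xs ys = subst (Equiv _ _) (∃*-++ ys xs B) (∃*-↭ (++-comm xs ys))

∃*-∧ˡ : All (_∉ free a G) xs → Equiv a (∃* xs (bin and B G)) (bin and (∃* xs B) G)
∃*-∧ˡ [] = ε
∃*-∧ˡ {xs = x ∷ xs} (x∉G ∷ xs∉G) = Equiv-qu ex x (∃*-∧ˡ xs∉G) ◅◅ step (P↓∃ x _ _ x∉G)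

card-free≤width : ∀ F → card (free a F) ≤ width a F
card-free≤width (hole i) = ≤-refl
card-free≤width (bin o F G) = m≤m⊔n _ _
card-free≤width (qu q x F) = m≤m⊔n _ _

width-∃* : ∀ xs → width a (∃* xs B) ≤ width a B
width-∃* [] = ≤-refl
width-∃* {a} {B} (x ∷ xs) = ⊔-lub
  (≤-trans (card-mono (remove-⊆ x (free a (∃* xs B))))
    (≤-trans (card-free≤width (∃* xs B)) (width-∃* xs)))
  (width-∃* xs)

width-binˡ : ∀ o F G → width a F ≤ width a (bin o F G)
width-binˡ {a} o F G = ≤-trans (m≤m⊔n (width a F) (width a G)) (m≤n⊔m (card (free a (bin o F G))) _)

width-binʳ : ∀ o F G → width a G ≤ width a (bin o F G)
width-binʳ {a} o F G = ≤-trans (m≤n⊔m (width a F) (width a G)) (m≤n⊔m (card (free a (bin o F G))) _)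

-- Restriction to a set of holes

-- Keep the holes in H and the quantifiers over variables outside D, delete everything else.
-- A kept quantifier whose scope loses all its holes cannot stay in place; it is recorded as
-- floating and read as an outermost ∃ of the restriction (∃* floating body).  Reading it as
-- ∃ is only faithful for {∃,∧}-formulas, which is why restrict-Step assumes IsExAnd.
module Restriction (a : Assoc) (H D : List ℕ) (H-avoids-D : ∀ {i} → i ∈ H → All (_∉ D) (a i)) where

  record Piece : Set where
    constructor piece
    field
      floating : List Var
      body : Maybe HF

  open Piece

  merge : Op → Maybe HF → Maybe HF → Maybe HF
  merge o (just B) (just B') = just (bin o B B')
  merge o (just B) nothing = just B
  merge o nothing m = m

  restrictHole : ∀ i → Dec (i ∈ H) → Piece
  restrictHole i (yes _) = piece [] (just (hole i))
  restrictHole i (no _) = piece [] nothing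

  restrictBin : Op → Piece → Piece → Piece
  restrictBin o p p' = piece (floating p ++ floating p') (merge o (body p) (body p'))

  restrictQu : Qu → ∀ x → Dec (x ∈ D) → Piece → Piece
  restrictQu q x (yes _) p = p
  restrictQu q x (no _) (piece xs (just B)) = piece xs (just (qu q x B))
  restrictQu q x (no _) (piece xs nothing) = piece (x ∷ xs) nothing

  restrict : HF → Piece
  restrict (hole i) = restrictHole i (i ∈? H)
  restrict (bin o F G) = restrictBin o (restrict F) (restrict G)
  restrict (qu q x F) = restrictQu q x (x ∈? D) (restrict F)

  infix 4 _≈_ _≼_

  data _≈_ : Piece → Piece → Set where
    floats : xs ↭ ys → piece xs nothing ≈ piece ys nothing
    bodies : Equiv a (∃* xs B) (∃* ys B') → piece xs (just B) ≈ piece ys (just B')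

  ≈-refl : ∀ {p} → p ≈ p
  ≈-refl {piece xs nothing} = floats ↭-refl
  ≈-refl {piece xs (just B)} = bodies ε

  ≈-sym : ∀ {p p'} → p ≈ p' → p' ≈ p
  ≈-sym (floats r) = floats (↭-sym r)
  ≈-sym (bodies r) = bodies (Equiv-sym r)

  ≈-trans : ∀ {p p' p''} → p ≈ p' → p' ≈ p'' → p ≈ p''
  ≈-trans (floats r) (floats r') = floats (↭-trans r r')
  ≈-trans (bodies r) (bodies r') = bodies (r ◅◅ r')

  ≈-↭ : ∀ m → xs ↭ ys → piece xs m ≈ piece ys m
  ≈-↭ nothing r = floats r
  ≈-↭ (just B) r = bodies (∃*-↭ r)

  record _≼_ (B F : HF) : Set where
    field
      free-⊆ : free a B ⊆ free a F
      free-avoids-D : All (_∉ D) (free a B)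
      width-≤ : width a B ≤ width a F

  open _≼_

  ≼-binˡ : B ≼ F → B ≼ bin o F G
  ≼-binˡ {F = F} {o = o} {G = G} B≼F = record
    { free-⊆ = xs⊆xs++ys _ _ ∘ free-⊆ B≼F
    ; free-avoids-D = free-avoids-D B≼F
    ; width-≤ = ≤-trans (width-≤ B≼F) (width-binˡ o F G)
    }

  ≼-binʳ : B ≼ G → B ≼ bin o F G
  ≼-binʳ {G = G} {o = o} {F = F} B≼G = record
    { free-⊆ = xs⊆ys++xs _ _ ∘ free-⊆ B≼G
    ; free-avoids-D = free-avoids-D B≼G
    ; width-≤ = ≤-trans (width-≤ B≼G) (width-binʳ o F G)
    }

  ≼-bin : B ≼ F → B' ≼ G → bin o B B' ≼ bin o F G
  ≼-bin B≼F B'≼G = record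
    { free-⊆ = ++⁺ (free-⊆ B≼F) (free-⊆ B'≼G)
    ; free-avoids-D = All.++⁺ (free-avoids-D B≼F) (free-avoids-D B'≼G)
    ; width-≤ = ⊔-mono-≤ (card-mono (++⁺ (free-⊆ B≼F) (free-⊆ B'≼G)))
                         (⊔-mono-≤ (width-≤ B≼F) (width-≤ B'≼G))
    }

  ≼-qu : B ≼ F → qu q x B ≼ qu q x F
  ≼-qu {x = x} B≼F = record
    { free-⊆ = remove⁺ x (free-⊆ B≼F)
    ; free-avoids-D = All.filter⁺ _ (free-avoids-D B≼F)
    ; width-≤ = ⊔-mono-≤ (card-mono (remove⁺ x (free-⊆ B≼F))) (width-≤ B≼F)
    }

  ≼-qu-∈ : x ∈ D → B ≼ F → B ≼ qu q x F
  ≼-qu-∈ x∈D B≼F = record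
    { free-⊆ = λ y∈B → ∈-remove⁺ (free-⊆ B≼F y∈B) λ { refl → All.lookup (free-avoids-D B≼F) y∈B x∈D }
    ; free-avoids-D = free-avoids-D B≼F
    ; width-≤ = ≤-trans (width-≤ B≼F) (m≤n⊔m _ _)
    }

  merge-≼ : ∀ o {m m'} →
    Maybe.All (_≼ F) m → Maybe.All (_≼ G) m' → Maybe.All (_≼ bin o F G) (merge o m m')
  merge-≼ o (just B≼F) (just B'≼G) = just (≼-bin B≼F B'≼G)
  merge-≼ o (just B≼F) nothing = just (≼-binˡ B≼F)
  merge-≼ o nothing m'≼G = Maybe.map ≼-binʳ m'≼G

  restrictQu-≼ : ∀ d p →
    Maybe.All (_≼ F) (body p) → Maybe.All (_≼ qu q x F) (body (restrictQu q x d p))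
  restrictQu-≼ (yes x∈D) p m≼F = Maybe.map (≼-qu-∈ x∈D) m≼F
  restrictQu-≼ (no _) (piece xs (just B)) (just B≼F) = just (≼-qu B≼F)
  restrictQu-≼ (no _) (piece xs nothing) nothing = nothing

  restrict-≼ : ∀ F → Maybe.All (_≼ F) (body (restrict F))
  restrict-≼ (hole i) with i ∈? H
  ... | yes i∈H = just (record { free-⊆ = id ; free-avoids-D = H-avoids-D i∈H ; width-≤ = ≤-refl })
  ... | no _ = nothing
  restrict-≼ (bin o F G) = merge-≼ o (restrict-≼ F) (restrict-≼ G)
  restrict-≼ (qu q x F) = restrictQu-≼ (x ∈? D) (restrict F) (restrict-≼ F)

  restrictQu-floating : ∀ d p → floating p ⊆ xs → floating (restrictQu q x d p) ⊆ x ∷ xs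
  restrictQu-floating (yes _) p p⊆xs = there ∘ p⊆xs
  restrictQu-floating (no _) (piece ys (just B)) p⊆xs = there ∘ p⊆xs
  restrictQu-floating (no _) (piece ys nothing) p⊆xs (here refl) = here refl
  restrictQu-floating (no _) (piece ys nothing) p⊆xs (there y∈ys) = there (p⊆xs y∈ys)

  floating-⊆-bound : ∀ F → floating (restrict F) ⊆ bound F
  floating-⊆-bound (hole i) with i ∈? H
  ... | yes _ = λ ()
  ... | no _ = λ ()
  floating-⊆-bound (bin o F G) = ++⁺ (floating-⊆-bound F) (floating-⊆-bound G)
  floating-⊆-bound (qu q x F) = restrictQu-floating (x ∈? D) (restrict F) (floating-⊆-bound F)

  restrictBin-assoc : ∀ o p p' p'' →
    restrictBin o p (restrictBin o p' p'') ≈ restrictBin o (restrictBin o p p') p''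
  restrictBin-assoc o (piece xs nothing) (piece ys m') (piece zs m'') =
    ≈-↭ (merge o m' m'') (↭-sym (++-assoc xs ys zs))
  restrictBin-assoc o (piece xs (just B)) (piece ys nothing) (piece zs m'') =
    ≈-↭ (merge o (just B) m'') (↭-sym (++-assoc xs ys zs))
  restrictBin-assoc o (piece xs (just B)) (piece ys (just B')) (piece zs nothing) =
    ≈-↭ (just (bin o B B')) (↭-sym (++-assoc xs ys zs))
  restrictBin-assoc o (piece xs (just B)) (piece ys (just B')) (piece zs (just B'')) =
    bodies (∃*-↭ (↭-sym (++-assoc xs ys zs)) ◅◅ ∃*-cong ((xs ++ ys) ++ zs) (step (A→ o B B' B'')))

  restrictBin-comm : ∀ o p p' → restrictBin o p p' ≈ restrictBin o p' p
  restrictBin-comm o (piece xs (just B)) (piece ys (just B')) =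
    bodies (∃*-↭ (++-comm xs ys) ◅◅ ∃*-cong (ys ++ xs) (step (C o B B')))
  restrictBin-comm o (piece xs (just B)) (piece ys nothing) = ≈-↭ (just B) (++-comm xs ys)
  restrictBin-comm o (piece xs nothing) (piece ys (just B')) = ≈-↭ (just B') (++-comm xs ys)
  restrictBin-comm o (piece xs nothing) (piece ys nothing) = ≈-↭ nothing (++-comm xs ys)

  restrictQu-comm : ∀ q x y dx dy p →
    restrictQu q x dx (restrictQu q y dy p) ≈ restrictQu q y dy (restrictQu q x dx p)
  restrictQu-comm q x y (yes _) dy p = ≈-refl
  restrictQu-comm q x y (no _) (yes _) p = ≈-refl
  restrictQu-comm q x y (no _) (no _) (piece xs (just B)) = bodies (∃*-cong xs (step (O q x y B)))
  restrictQu-comm q x y (no _) (no _) (piece xs nothing) = floats (swap x y ↭-refl)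

  restrictQu-∧ : ∀ x d p p' → Maybe.All (λ B → x ∉ free a B) (body p') →
    restrictQu ex x d (restrictBin and p p') ≈ restrictBin and (restrictQu ex x d p) p'
  restrictQu-∧ x (yes _) p p' _ = ≈-refl
  restrictQu-∧ x (no _) (piece xs (just B)) (piece ys (just B')) (just x∉B') =
    bodies (∃*-cong (xs ++ ys) (step (P↓∃ x B B' x∉B')))
  restrictQu-∧ x (no _) (piece xs (just B)) (piece ys nothing) _ = ≈-refl
  restrictQu-∧ x (no _) (piece xs nothing) (piece ys (just B')) _ = bodies (∃*-∃ (xs ++ ys))
  restrictQu-∧ x (no _) (piece xs nothing) (piece ys nothing) _ = ≈-refl

  restrictQu-cong : ∀ x d {p p'} → p ≈ p' → restrictQu ex x d p ≈ restrictQu ex x d p'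
  restrictQu-cong x (yes _) r = r
  restrictQu-cong x (no _) (floats r) = floats (prep x r)
  restrictQu-cong x (no _) (bodies {xs = xs} {ys = ys} r) =
    bodies (∃*-∃ xs ◅◅ Equiv-qu ex x r ◅◅ Equiv-sym (∃*-∃ ys))

  restrictBin-congˡ : ∀ {S p p'} p'' → p ≈ p' →
    All (_∉ S) (floating p) → All (_∉ S) (floating p') → Maybe.All (λ B → free a B ⊆ S) (body p'') →
    restrictBin and p p'' ≈ restrictBin and p' p''
  restrictBin-congˡ (piece zs nothing) (floats r) _ _ _ = floats (++⁺ʳ zs r)
  restrictBin-congˡ (piece zs (just B'')) (floats r) _ _ _ = bodies (∃*-↭ (++⁺ʳ zs r))
  restrictBin-congˡ (piece zs nothing) (bodies {xs = xs} {ys = ys} r) _ _ _ =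
    bodies (∃*-++-swap xs zs ◅◅ ∃*-cong zs r ◅◅ Equiv-sym (∃*-++-swap ys zs))
  restrictBin-congˡ {S} (piece zs (just B'')) (bodies {xs = xs} {ys = ys} r) xs∉S ys∉S (just B''⊆S) =
    bodies (∃*-++-swap xs zs
      ◅◅ ∃*-cong zs (∃*-∧ˡ (avoid xs∉S) ◅◅ Equiv-binˡ and B'' r ◅◅ Equiv-sym (∃*-∧ˡ (avoid ys∉S)))
      ◅◅ Equiv-sym (∃*-++-swap ys zs))
    where
    avoid : ∀ {vs} → All (_∉ S) vs → All (_∉ free a B'') vs
    avoid = All.map (λ x∉S → x∉S ∘ B''⊆S)

  restrictBin-congʳ : ∀ {S p p'} p'' → p ≈ p' →
    All (_∉ S) (floating p) → All (_∉ S) (floating p') → Maybe.All (λ B → free a B ⊆ S) (body p'') →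
    restrictBin and p'' p ≈ restrictBin and p'' p'
  restrictBin-congʳ {p = p} {p'} p'' r p∉S p'∉S p''⊆S = ≈-trans (restrictBin-comm and p'' p)
    (≈-trans (restrictBin-congˡ p'' r p∉S p'∉S p''⊆S) (restrictBin-comm and p' p''))

  restrict-free-⊆ : ∀ F → Maybe.All (λ B → free a B ⊆ free a F) (body (restrict F))
  restrict-free-⊆ F = Maybe.map free-⊆ (restrict-≼ F)

  restrict-∉ : ∀ F → x ∉ free a F → Maybe.All (λ B → x ∉ free a B) (body (restrict F))
  restrict-∉ F x∉F = Maybe.map (λ B⊆F x∈B → x∉F (B⊆F x∈B)) (restrict-free-⊆ F)

  floating-avoidsˡ : ∀ o F G → Standardized a (bin o F G) → All (_∉ free a G) (floating (restrict F))
  floating-avoidsˡ o F G = All-resp-⊇ (floating-⊆-bound F) ∘ bound-free-disjointˡ o F G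

  floating-avoidsʳ : ∀ o F G → Standardized a (bin o F G) → All (_∉ free a F) (floating (restrict G))
  floating-avoidsʳ o F G = All-resp-⊇ (floating-⊆-bound G) ∘ bound-free-disjointʳ o F G

  restrict-Step : Step a ψ ψ' → Standardized a ψ → IsExAnd ψ → restrict ψ ≈ restrict ψ'
  restrict-Step (A→ o F₁ F₂ F₃) _ _ = restrictBin-assoc o (restrict F₁) (restrict F₂) (restrict F₃)
  restrict-Step (A← o F₁ F₂ F₃) _ _ =
    ≈-sym (restrictBin-assoc o (restrict F₁) (restrict F₂) (restrict F₃))
  restrict-Step (C o F₁ F₂) _ _ = restrictBin-comm o (restrict F₁) (restrict F₂)
  restrict-Step (O q x y F) _ _ = restrictQu-comm q x y (x ∈? D) (y ∈? D) (restrict F)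
  restrict-Step (P↓∃ x F₁ F₂ x∉F₂) _ _ =
    restrictQu-∧ x (x ∈? D) (restrict F₁) (restrict F₂) (restrict-∉ F₂ x∉F₂)
  restrict-Step (P↑∃ x F₁ F₂ x∉F₂) _ _ = ≈-sym
    (restrictQu-∧ x (x ∈? D) (restrict F₁) (restrict F₂) (restrict-∉ F₂ x∉F₂))
  restrict-Step s@(congL {F} {F'} o G s') std (c eF _) =
    restrictBin-congˡ (restrict G) (restrict-Step s' (Standardized-binˡ o F G std) eF)
      (floating-avoidsˡ o F G std) (floating-avoidsˡ o F' G (Standardized-Step s std)) (restrict-free-⊆ G)
  restrict-Step s@(congR {G} {G'} o F s') std (c _ eG) =
    restrictBin-congʳ (restrict F) (restrict-Step s' (Standardized-binʳ o F G std) eG)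
      (floating-avoidsʳ o F G std) (floating-avoidsʳ o F G' (Standardized-Step s std)) (restrict-free-⊆ F)
  restrict-Step (congQ {F} q x s) std (e eF) =
    restrictQu-cong x (x ∈? D) (restrict-Step s (Standardized-qu q x F std) eF)

  restrict-Equiv : Equiv a ψ ψ' → Standardized a ψ → IsExAnd ψ → restrict ψ ≈ restrict ψ'
  restrict-Equiv ε _ _ = ≈-refl
  restrict-Equiv (s ◅ ss) std exand = ≈-trans (restrict-Step s' std exand)
    (restrict-Equiv ss (Standardized-Step s' std) (IsExAnd-Step s' exand))
    where s' = Step±⇒Step s

  restrict-kept : ∀ F → All (_∈ H) (holes F) → All (_∉ D) (bound F) → restrict F ≡ piece [] (just F)
  restrict-kept (hole i) (i∈H ∷ []) _ with i ∈? H
  ... | yes _ = refl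
  ... | no i∉H = contradiction i∈H i∉H
  restrict-kept (bin o F G) hs bs
    rewrite restrict-kept F (All.++⁻ˡ (holes F) hs) (All.++⁻ˡ (bound F) bs)
          | restrict-kept G (All.++⁻ʳ (holes F) hs) (All.++⁻ʳ (bound F) bs) = refl
  restrict-kept (qu q x F) hs (x∉D ∷ bs) with x ∈? D
  ... | yes x∈D = contradiction x∈D x∉D
  ... | no _ rewrite restrict-kept F hs bs = refl

  restrict-dropped : ∀ F → All (_∉ H) (holes F) → All (_∈ D) (bound F) → restrict F ≡ piece [] nothing
  restrict-dropped (hole i) (i∉H ∷ []) _ with i ∈? H
  ... | yes i∈H = contradiction i∈H i∉H
  ... | no _ = refl
  restrict-dropped (bin o F G) hs bs
    rewrite restrict-dropped F (All.++⁻ˡ (holes F) hs) (All.++⁻ˡ (bound F) bs)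
          | restrict-dropped G (All.++⁻ʳ (holes F) hs) (All.++⁻ʳ (bound F) bs) = refl
  restrict-dropped (qu q x F) hs (x∈D ∷ bs) with x ∈? D
  ... | yes _ = restrict-dropped F hs bs
  ... | no x∉D = contradiction x∈D x∉D

  restrict-class-width : Equiv a ψ ψ' → Standardized a ψ → IsExAnd ψ →
    restrict ψ ≡ piece [] (just F) →
    ∃[ χ ] Equiv a F χ × width a χ ≤ width a ψ'
  restrict-class-width {ψ' = ψ'} ψ~ψ' std exand restrict-ψ
    with restrict ψ' | restrict-≼ ψ' | subst (_≈ restrict ψ') restrict-ψ (restrict-Equiv ψ~ψ' std exand)
  ... | piece xs (just B) | just B≼ψ' | bodies F~B =
    ∃* xs B , F~B , ≤-trans (width-∃* xs) (width-≤ B≼ψ')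

restrict-conjunctˡ : ∀ {a φ φ' ψ} →
  IsHoley (bin and φ φ') → IsExAnd (bin and φ φ') → Standardized a (bin and φ φ') →
  Equiv a (bin and φ φ') ψ → ∃[ χ ] Equiv a φ χ × width a χ ≤ width a ψ
restrict-conjunctˡ {a} {φ} {φ'} holey exand std θ~ψ = restrict-class-width θ~ψ std exand restrict-θ
  where
  holes-disjoint : Disjoint (holes φ) (holes φ')
  holes-disjoint = proj₂ (proj₂ (Unique-++⁻ (holes φ) holey))

  bounds-disjoint : Disjoint (bound φ) (bound φ')
  bounds-disjoint = proj₂ (proj₂ (Unique-++⁻ (bound φ) (proj₁ std)))

  holes-φ-avoid-bound-φ' : ∀ {i} → i ∈ holes φ → All (_∉ bound φ') (a i)
  holes-φ-avoid-bound-φ' i∈φ = All.tabulate λ y∈ai y∈φ' →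
    [ (λ y∈free → All.lookup (bound-free-disjointʳ and φ φ' std) y∈φ' y∈free)
    , (λ y∈bound → bounds-disjoint (y∈bound , y∈φ'))
    ]′ (hole-var-free⊎bound φ i∈φ y∈ai)

  open Restriction a (holes φ) (bound φ') holes-φ-avoid-bound-φ'

  restrict-θ : restrict (bin and φ φ') ≡ piece [] (just φ)
  restrict-θ
    rewrite restrict-kept φ (All.tabulate id) (All.tabulate λ x∈φ x∈φ' → bounds-disjoint (x∈φ , x∈φ'))
          | restrict-dropped φ' (All.tabulate λ i∈φ' i∈φ → holes-disjoint (i∈φ , i∈φ'))
                                (All.tabulate id)
          = refl

restrict-conjunctʳ : ∀ {a φ φ' ψ} →
  IsHoley (bin and φ φ') → IsExAnd (bin and φ φ') → Standardized a (bin and φ φ') →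
  Equiv a (bin and φ φ') ψ → ∃[ χ ] Equiv a φ' χ × width a χ ≤ width a ψ
restrict-conjunctʳ {φ = φ} {φ'} holey (c eφ eφ') std θ~ψ = restrict-conjunctˡ
  (Unique-resp-↭ (↭⇒↭ₛ (++-comm (holes φ) (holes φ'))) holey) (c eφ' eφ)
  (Standardized-Step (C and φ φ') std) (step (C and φ' φ) ◅◅ θ~ψ)

theorem9p1 : (a : Assoc) (φ φ' : HF) →
    IsHoley (bin and φ φ') → IsExAnd (bin and φ φ') → Standardized a (bin and φ φ') →
    (w w' : ℕ) → IsClassWidth a φ w → IsClassWidth a φ' w' →
    IsClassWidth a (bin and φ φ') (w ⊔ w' ⊔ card (free a φ ++ free a φ'))
theorem9p1 a φ φ' holey exand std _ _ ((ψ , φ~ψ , refl) , ψ-least) ((ψ' , φ'~ψ' , refl) , ψ'-least) =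
  (bin and ψ ψ' , Equiv-bin and φ~ψ φ'~ψ' , width-ψ∧ψ') , least
  where
  card-free : ∀ {χ} → Equiv a (bin and φ φ') χ → card (free a (bin and φ φ')) ≡ card (free a χ)
  card-free = card-↭ ∘ free-Equiv

  width-ψ∧ψ' : width a (bin and ψ ψ') ≡ width a ψ ⊔ width a ψ' ⊔ card (free a φ ++ free a φ')
  width-ψ∧ψ' = ≡.trans (cong (_⊔ (width a ψ ⊔ width a ψ')) (sym (card-free (Equiv-bin and φ~ψ φ'~ψ'))))
    (⊔-comm (card (free a φ ++ free a φ')) (width a ψ ⊔ width a ψ'))

  least : ∀ χ → Equiv a (bin and φ φ') χ →
    width a ψ ⊔ width a ψ' ⊔ card (free a φ ++ free a φ') ≤ width a χ
  least χ θ~χ with restrict-conjunctˡ holey exand std θ~χ | restrict-conjunctʳ holey exand std θ~χ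
  ... | χ₁ , φ~χ₁ , χ₁≤χ | χ₂ , φ'~χ₂ , χ₂≤χ = ⊔-lub
    (⊔-lub (≤-trans (ψ-least χ₁ φ~χ₁) χ₁≤χ) (≤-trans (ψ'-least χ₂ φ'~χ₂) χ₂≤χ))
    (≤-trans (≤-reflexive (card-free θ~χ)) (card-free≤width χ))
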